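{- Let $m \geq 2$ and $f(x) = \sum_{i=0}^d c_i x^i \in \mathbb{Z}[x]$ squarefree of degree $d \geq m$. For polynomials $g,h,\gamma,\eta$ put \[ F_{g,h,\gamma,\eta}(t) = h(t)^m\Big(c_d\gamma(t)^d + c_{d-1}\gamma(t)^{d-1}\eta(t) + \cdots + c_0\eta(t)^d\Big) - g(t)^m\eta(t)^d. \] For every integer $n \geq \max(d, \operatorname{lcm}(m,d) - m - d + 1)$ with $\gcd(m,d) \mid n$, there exist $g,h,\gamma,\eta$ such that $F_{g,h,\gamma,\eta}(t)$ has degree $n$. Explicitly, one can take $\eta = 1$ and $g,h,\gamma$ with degrees $\deg g = n/m$, $\deg h = \lfloor (n-d)/m \rfloor$, $\deg \gamma = 1$ when $m \mid n$, and $\deg g = \lfloor n/m \rfloor$, $\deg h = (n - rd)/m$, $\deg \gamma = r$ when $m \nmid n$, where $r>0$ is the minimal integer such that $n \equiv rd \pmod m$. -}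

module Defs where

open import Data.Nat as ℕ using (ℕ; zero; suc; _<_; _∸_)
open import Data.Integer as ℤ using (ℤ; +_; _+_; _*_; -_; _-_)
open import Data.Integer.Divisibility as ℤD using ()
open import Data.List using (List; []; _∷_; map)
open import Data.Product using (Σ; ∃; _×_)
open import Relation.Binary.PropositionalEquality using (_≡_; _≢_)
open import Relation.Nullary using (¬_)

-- Polynomials in ℤ[x] as little-endian coefficient lists (trailing zeros allowed;
-- all notions below are stated via coefficients, hence representation independent).
Poly : Set
Poly = List ℤ

coeff : Poly → ℕ → ℤ
coeff []       _       = + 0
coeff (a ∷ p)  zero    = a
coeff (a ∷ p)  (suc k) = coeff p k

_≈ₚ_ : Poly → Poly → Set
p ≈ₚ q = ∀ k → coeff p k ≡ coeff q k

HasDegree : Poly → ℕ → Set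
HasDegree p k = (coeff p k ≢ + 0) × (∀ j → k < j → coeff p j ≡ + 0)

constP : ℤ → Poly
constP a = a ∷ []

oneP : Poly
oneP = constP (+ 1)

_+ₚ_ : Poly → Poly → Poly
[]      +ₚ q       = q
(a ∷ p) +ₚ []      = a ∷ p
(a ∷ p) +ₚ (b ∷ q) = (a + b) ∷ (p +ₚ q)

scaleP : ℤ → Poly → Poly
scaleP c p = map (c *_) p

negP : Poly → Poly
negP = scaleP (- (+ 1))

_-ₚ_ : Poly → Poly → Poly
p -ₚ q = p +ₚ negP q

_*ₚ_ : Poly → Poly → Poly
[]      *ₚ q = []
(a ∷ p) *ₚ q = scaleP a q +ₚ (+ 0 ∷ (p *ₚ q))

_^ₚ_ : Poly → ℕ → Poly
p ^ₚ zero  = oneP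
p ^ₚ suc k = p *ₚ (p ^ₚ k)

SquareFree : Poly → Set
SquareFree f = ¬ (Σ Poly λ q → Σ ℕ λ k → (1 ℕ.≤ k) × HasDegree q k ×
                   Σ Poly λ s → f ≈ₚ ((q *ₚ q) *ₚ s))

homSum : Poly → ℕ → Poly → Poly → Poly
homSum f d γ η = go d
  where
  term : ℕ → Poly
  term i = scaleP (coeff f i) ((γ ^ₚ i) *ₚ (η ^ₚ (d ∸ i)))
  go : ℕ → Poly
  go zero    = term zero
  go (suc i) = term (suc i) +ₚ go i

Fpoly : ℕ → ℕ → Poly → Poly → Poly → Poly → Poly → Poly
Fpoly m d f g h γ η = ((h ^ₚ m) *ₚ homSum f d γ η) -ₚ ((g ^ₚ m) *ₚ (η ^ₚ d))

CongMod : ℕ → ℕ → ℕ → Set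
CongMod m a b = (+ m) ℤD.∣ ((+ a) - (+ b))

IsMinimalR : ℕ → ℕ → ℕ → ℕ → Set
IsMinimalR m n d r = (0 < r) × CongMod m n (r ℕ.* d)
                     × (∀ r′ → 0 < r′ → r′ < r → ¬ CongMod m n (r′ ℕ.* d))

{-# OPTIONS --safe #-}
-- With η = 1 and γ a monomial of degree r, the homogenised sum is f(γ), of degree rd with
-- leading coefficient c_d, so with monomials g and h the polynomial F = h^m f(γ) − g^m has two
-- competing top terms, of degrees m·deg h + rd and m·deg g. If m ∤ n, take r minimal with
-- n ≡ rd (mod m): as d·(lcm(m,d)/d) ≡ 0 (mod m), minimality gives r < lcm(m,d)/d, hence
-- rd ≤ lcm(m,d) − d < n + m by hypothesis, and rd ≡ n forces rd ≤ n; so deg h = (n − rd)/m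
-- makes the first term of degree exactly n, while m·⌊n/m⌋ < n. If m ∣ n, take r = 1 and let g^m
-- reach degree n, giving g a leading coefficient a with a^m ≠ c_d in case the two terms meet.
module Submission where

open import Defs
open import Data.Empty using (⊥-elim)
open import Data.Integer as ℤ using (ℤ; +_; -_)
import Data.Integer.Divisibility.Signed as ℤS
import Data.Integer.Properties as ℤP
import Data.Integer.Tactic.RingSolver as ℤSolver
open import Data.List using ([]; _∷_)
open import Data.Nat as ℕ using (ℕ; zero; suc; _+_; _*_; _∸_; _≤_; _<_; z≤n; s≤s; ∣_-_∣)
open import Data.Nat.Divisibility as ℕD using (_∣_; divides; _∣?_)
open import Data.Nat.DivMod using (_/_; _%_; m/n*n≤m; m≡m%n+[m/n]*n; m%n<n)
open import Data.Nat.GCD using (gcd; gcd-GCD; module Bézout)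
open import Data.Nat.LCM using (lcm; m∣lcm[m,n]; n∣lcm[m,n]; gcd*lcm)
import Data.Nat.Properties as ℕP
import Data.Nat.Tactic.RingSolver as ℕSolver
open import Data.Product using (Σ; ∃; _×_; _,_; proj₁; proj₂)
open import Data.Sum using (inj₁; inj₂)
open import Function using (_∘_)
open import Relation.Binary.Definitions using (tri<; tri≈; tri>)
open import Relation.Binary.PropositionalEquality
  using (_≡_; _≢_; refl; sym; trans; cong; cong₂; subst; subst₂; module ≡-Reasoning)
open import Relation.Nullary using (¬_; Dec; yes; no)

record DegreeAtMost (p : Poly) (a : ℕ) : Set where
  constructor vanishingAbove
  field vanishes : ∀ j → a < j → coeff p j ≡ + 0

record TopCoeff (p : Poly) (a : ℕ) (c : ℤ) : Set where
  constructor topCoeff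
  field
    coeff≡  : coeff p a ≡ c
    degree≤ : DegreeAtMost p a

open DegreeAtMost
open TopCoeff

monomial : ℕ → ℤ → Poly
monomial zero    c = c ∷ []
monomial (suc k) c = + 0 ∷ monomial k c

coeff-+ₚ : ∀ p q k → coeff (p +ₚ q) k ≡ coeff p k ℤ.+ coeff q k
coeff-+ₚ []      q       k       = sym (ℤP.+-identityˡ _)
coeff-+ₚ (a ∷ p) []      k       = sym (ℤP.+-identityʳ _)
coeff-+ₚ (a ∷ p) (b ∷ q) zero    = refl
coeff-+ₚ (a ∷ p) (b ∷ q) (suc k) = coeff-+ₚ p q k

coeff-scaleP : ∀ c p k → coeff (scaleP c p) k ≡ c ℤ.* coeff p k
coeff-scaleP c []      k       = sym (ℤP.*-zeroʳ c)
coeff-scaleP c (a ∷ p) zero    = refl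
coeff-scaleP c (a ∷ p) (suc k) = coeff-scaleP c p k

coeff--ₚ : ∀ p q k → coeff (p -ₚ q) k ≡ coeff p k ℤ.- coeff q k
coeff--ₚ p q k = begin
  coeff (p +ₚ negP q) k              ≡⟨ coeff-+ₚ p (negP q) k ⟩
  coeff p k ℤ.+ coeff (negP q) k     ≡⟨ cong (λ t → coeff p k ℤ.+ t) (coeff-scaleP (- + 1) q k) ⟩
  coeff p k ℤ.+ - + 1 ℤ.* coeff q k  ≡⟨ cong (λ t → coeff p k ℤ.+ t) (ℤP.-1*i≡-i (coeff q k)) ⟩
  coeff p k ℤ.- coeff q k            ∎
  where open ≡-Reasoning

coeff-∷-*ₚ : ∀ x p q k → coeff ((x ∷ p) *ₚ q) k ≡ x ℤ.* coeff q k ℤ.+ coeff (+ 0 ∷ (p *ₚ q)) k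
coeff-∷-*ₚ x p q k = trans (coeff-+ₚ (scaleP x q) _ k) (cong (ℤ._+ _) (coeff-scaleP x q k))

∷-zero : ∀ {p} → p ≈ₚ [] → (+ 0 ∷ p) ≈ₚ []
∷-zero p≈0 zero    = refl
∷-zero p≈0 (suc k) = p≈0 k

*ₚ-zeroˡ : ∀ p q → p ≈ₚ [] → (p *ₚ q) ≈ₚ []
*ₚ-zeroˡ []      q p≈0 k = refl
*ₚ-zeroˡ (x ∷ p) q p≈0 k = begin
  coeff ((x ∷ p) *ₚ q) k                              ≡⟨ coeff-∷-*ₚ x p q k ⟩
  x ℤ.* coeff q k ℤ.+ coeff (+ 0 ∷ (p *ₚ q)) k        ≡⟨ cong₂ ℤ._+_ (cong (ℤ._* coeff q k) (p≈0 zero))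
                                                                     (∷-zero (*ₚ-zeroˡ p q (p≈0 ∘ suc)) k) ⟩
  + 0 ℤ.* coeff q k ℤ.+ + 0                           ≡⟨ ℤP.+-identityʳ _ ⟩
  + 0 ℤ.* coeff q k                                   ≡⟨ ℤP.*-zeroˡ (coeff q k) ⟩
  + 0                                                 ∎
  where open ≡-Reasoning

+ₚ-identityʳ-≈ₚ : ∀ p {q} → q ≈ₚ [] → (p +ₚ q) ≈ₚ p
+ₚ-identityʳ-≈ₚ p {q} q≈0 k = trans (coeff-+ₚ p q k) (trans (cong (λ t → coeff p k ℤ.+ t) (q≈0 k)) (ℤP.+-identityʳ _))

TopCoeff-resp-≈ₚ : ∀ {p q a c} → p ≈ₚ q → TopCoeff p a c → TopCoeff q a c
TopCoeff-resp-≈ₚ {a = a} p≈q (topCoeff top (vanishingAbove deg)) =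
  topCoeff (trans (sym (p≈q a)) top) (vanishingAbove λ j a<j → trans (sym (p≈q j)) (deg j a<j))

TopCoeff⇒HasDegree : ∀ {p a c} → TopCoeff p a c → c ≢ + 0 → HasDegree p a
TopCoeff⇒HasDegree (topCoeff top deg) c≢0 = c≢0 ∘ trans (sym top) , vanishes deg

TopCoeff-monomial : ∀ k c → TopCoeff (monomial k c) k c
TopCoeff-monomial zero    c = topCoeff refl (vanishingAbove λ { (suc j) _ → refl })
TopCoeff-monomial (suc k) c = topCoeff (coeff≡ t) (vanishingAbove λ { (suc j) (s≤s k<j) → vanishes (degree≤ t) j k<j })
  where
  t : TopCoeff (monomial k c) k c
  t = TopCoeff-monomial k c

TopCoeff-raise : ∀ {p a n} → DegreeAtMost p a → a < n → TopCoeff p n (+ 0)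
TopCoeff-raise (vanishingAbove deg) a<n = topCoeff (deg _ a<n) (vanishingAbove λ j n<j → deg j (ℕP.<-trans a<n n<j))

DegreeAtMost-mono : ∀ {p a b} → a ≤ b → DegreeAtMost p a → DegreeAtMost p b
DegreeAtMost-mono a≤b (vanishingAbove deg) = vanishingAbove λ j b<j → deg j (ℕP.≤-<-trans a≤b b<j)

TopCoeff-scaleP : ∀ {p a c} x → TopCoeff p a c → TopCoeff (scaleP x p) a (x ℤ.* c)
TopCoeff-scaleP {p} {a} x (topCoeff top (vanishingAbove deg)) = topCoeff
  (trans (coeff-scaleP x p a) (cong (x ℤ.*_) top))
  (vanishingAbove λ j a<j → trans (coeff-scaleP x p j) (trans (cong (x ℤ.*_) (deg j a<j)) (ℤP.*-zeroʳ x)))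

DegreeAtMost-+ₚ : ∀ {p q a} → DegreeAtMost p a → DegreeAtMost q a → DegreeAtMost (p +ₚ q) a
DegreeAtMost-+ₚ {p} {q} (vanishingAbove degp) (vanishingAbove degq) =
  vanishingAbove λ j a<j → trans (coeff-+ₚ p q j) (cong₂ ℤ._+_ (degp j a<j) (degq j a<j))

TopCoeff-+ₚˡ : ∀ {p q a b c} → TopCoeff p a c → DegreeAtMost q b → b < a → TopCoeff (p +ₚ q) a c
TopCoeff-+ₚˡ {p} {q} {a} (topCoeff top degp) degq b<a = topCoeff
  (trans (coeff-+ₚ p q a) (trans (cong₂ ℤ._+_ top (vanishes degq a b<a)) (ℤP.+-identityʳ _)))
  (DegreeAtMost-+ₚ degp (DegreeAtMost-mono (ℕP.<⇒≤ b<a) degq))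

TopCoeff-+ₚʳ : ∀ {p q a b c} → DegreeAtMost p b → TopCoeff q a c → b < a → TopCoeff (p +ₚ q) a c
TopCoeff-+ₚʳ {p} {q} {a} degp (topCoeff top degq) b<a = topCoeff
  (trans (coeff-+ₚ p q a) (trans (cong₂ ℤ._+_ (vanishes degp a b<a) top) (ℤP.+-identityˡ _)))
  (DegreeAtMost-+ₚ (DegreeAtMost-mono (ℕP.<⇒≤ b<a) degp) degq)

TopCoeff-∷ : ∀ {p a c} → TopCoeff p a c → TopCoeff (+ 0 ∷ p) (suc a) c
TopCoeff-∷ (topCoeff top (vanishingAbove deg)) = topCoeff top (vanishingAbove λ { (suc j) (s≤s a<j) → deg j a<j })

TopCoeff-*ₚ : ∀ {p q a b c e} → TopCoeff p a c → TopCoeff q b e → TopCoeff (p *ₚ q) (a + b) (c ℤ.* e)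
TopCoeff-*ₚ {[]} {e = e} (topCoeff top _) _ =
  topCoeff (trans (sym (ℤP.*-zeroˡ e)) (cong (ℤ._* e) top)) (vanishingAbove λ _ _ → refl)
TopCoeff-*ₚ {x ∷ p} {q} {zero} (topCoeff refl (vanishingAbove deg)) topq =
  TopCoeff-resp-≈ₚ (λ k → sym (+ₚ-identityʳ-≈ₚ (scaleP x q) tail≈0 k)) (TopCoeff-scaleP x topq)
  where
  tail≈0 : (+ 0 ∷ (p *ₚ q)) ≈ₚ []
  tail≈0 = ∷-zero (*ₚ-zeroˡ p q λ j → deg (suc j) (s≤s z≤n))
TopCoeff-*ₚ {x ∷ p} {q} {suc a} {b} (topCoeff top (vanishingAbove deg)) topq =
  TopCoeff-+ₚʳ (degree≤ (TopCoeff-scaleP x topq))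
               (TopCoeff-∷ (TopCoeff-*ₚ {p} (topCoeff top (vanishingAbove λ j a<j → deg (suc j) (s≤s a<j))) topq))
               (s≤s (ℕP.m≤n+m b a))

TopCoeff-^ₚ : ∀ {p a c} → TopCoeff p a c → ∀ k → TopCoeff (p ^ₚ k) (k * a) (c ℤ.^ k)
TopCoeff-^ₚ top zero    = TopCoeff-monomial zero (+ 1)
TopCoeff-^ₚ top (suc k) = TopCoeff-*ₚ top (TopCoeff-^ₚ top k)

TopCoeff-*ₚ-oneP^ₚ : ∀ {p a c} k → TopCoeff p a c → TopCoeff (p *ₚ (oneP ^ₚ k)) a c
TopCoeff-*ₚ-oneP^ₚ {a = a} {c} k top =
  subst₂ (TopCoeff _) (trans (cong (λ t → a + t) (ℕP.*-zeroʳ k)) (ℕP.+-identityʳ a))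
                      (trans (cong (c ℤ.*_) (ℤP.^-zeroˡ k)) (ℤP.*-identityʳ c))
         (TopCoeff-*ₚ top (TopCoeff-^ₚ (TopCoeff-monomial zero (+ 1)) k))

HasDegree--ₚ : ∀ {p q n c e} → TopCoeff p n c → TopCoeff q n e → c ≢ e → HasDegree (p -ₚ q) n
HasDegree--ₚ {p} {q} {n} {c} {e} (topCoeff topp (vanishingAbove degp)) (topCoeff topq (vanishingAbove degq)) c≢e =
  (λ eq → c≢e (ℤP.i-j≡0⇒i≡j c e (trans (sym (trans (coeff--ₚ p q n) (cong₂ ℤ._-_ topp topq))) eq))) ,
  λ j n<j → trans (coeff--ₚ p q j) (cong₂ ℤ._-_ (degp j n<j) (degq j n<j))

homTerm : Poly → ℕ → Poly → Poly → ℕ → Poly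
homTerm f d γ η i = scaleP (coeff f i) ((γ ^ₚ i) *ₚ (η ^ₚ (d ∸ i)))

partialHomSum : Poly → ℕ → Poly → Poly → ℕ → Poly
partialHomSum f d γ η zero    = homTerm f d γ η zero
partialHomSum f d γ η (suc i) = homTerm f d γ η (suc i) +ₚ partialHomSum f d γ η i

partialHomSum-unique : ∀ f d γ η (G : ℕ → Poly) → G 0 ≡ homTerm f d γ η 0 →
                       (∀ i → G (suc i) ≡ homTerm f d γ η (suc i) +ₚ G i) →
                       ∀ i → G i ≡ partialHomSum f d γ η i
partialHomSum-unique f d γ η G G₀ Gₛ zero    = G₀
partialHomSum-unique f d γ η G G₀ Gₛ (suc i) =
  trans (Gₛ i) (cong (homTerm f d γ η (suc i) +ₚ_) (partialHomSum-unique f d γ η G G₀ Gₛ i))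

-- homSum sums with a where-local function that cannot be named here; abstracting the
-- parameter suc d apart from the summation index d lets unification recover it as G.
homSum≡partialHomSum : ∀ f d γ η → homSum f d γ η ≡ partialHomSum f d γ η d
homSum≡partialHomSum f zero    γ η = refl
homSum≡partialHomSum f (suc d) γ η with suc d
... | D with partialHomSum-unique f D γ η _ refl (λ _ → refl) | d
...   | homSum-go≡partialHomSum | i = cong₂ _+ₚ_ refl (homSum-go≡partialHomSum i)

module _ {f γ : Poly} {r : ℕ} {c : ℤ} (γ-top : TopCoeff γ r c) (d : ℕ) where

  TopCoeff-homTerm : ∀ i → TopCoeff (homTerm f d γ oneP i) (i * r) (coeff f i ℤ.* c ℤ.^ i)
  TopCoeff-homTerm i = TopCoeff-scaleP (coeff f i) (TopCoeff-*ₚ-oneP^ₚ (d ∸ i) (TopCoeff-^ₚ γ-top i))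

  DegreeAtMost-partialHomSum : ∀ i → DegreeAtMost (partialHomSum f d γ oneP i) (i * r)
  DegreeAtMost-partialHomSum zero    = degree≤ (TopCoeff-homTerm zero)
  DegreeAtMost-partialHomSum (suc i) =
    DegreeAtMost-+ₚ (degree≤ (TopCoeff-homTerm (suc i)))
                    (DegreeAtMost-mono (ℕP.m≤n+m (i * r) r) (DegreeAtMost-partialHomSum i))

  TopCoeff-partialHomSum : 0 < r → ∀ i → TopCoeff (partialHomSum f d γ oneP i) (i * r) (coeff f i ℤ.* c ℤ.^ i)
  TopCoeff-partialHomSum 0<r zero    = TopCoeff-homTerm zero
  TopCoeff-partialHomSum 0<r (suc i) =
    TopCoeff-+ₚˡ (TopCoeff-homTerm (suc i)) (DegreeAtMost-partialHomSum i) (ℕP.+-monoˡ-≤ (i * r) 0<r)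

TopCoeff-homSum : ∀ {f γ r c} d → TopCoeff γ r c → 0 < r →
                  TopCoeff (homSum f d γ oneP) (d * r) (coeff f d ℤ.* c ℤ.^ d)
TopCoeff-homSum {f} {γ} d γ-top 0<r =
  subst (λ h → TopCoeff h _ _) (sym (homSum≡partialHomSum f d γ oneP)) (TopCoeff-partialHomSum γ-top d 0<r d)

∣+m-+n∣≡∣m-n∣ : ∀ m n → ℤ.∣ + m ℤ.- + n ∣ ≡ ∣ m - n ∣
∣+m-+n∣≡∣m-n∣ m n with ℕP.≤-total n m
... | inj₁ n≤m = trans (cong ℤ.∣_∣ (trans (ℤP.[+m]-[+n]≡m⊖n m n) (ℤP.⊖-≥ n≤m))) (sym (ℕP.m≤n⇒∣n-m∣≡n∸m n≤m))
... | inj₂ m≤n = trans (cong ℤ.∣_∣ (ℤP.[+m]-[+n]≡m⊖n m n)) (trans (ℤP.∣⊖∣-≤ m≤n) (sym (ℕP.m≤n⇒∣m-n∣≡n∸m m≤n)))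

CongMod⇒∣∣-∣ : ∀ {m a b} → CongMod m a b → m ∣ ∣ a - b ∣
CongMod⇒∣∣-∣ {m} {a} {b} = subst (m ∣_) (∣+m-+n∣≡∣m-n∣ a b)

∣∣-∣⇒CongMod : ∀ {m a b} → m ∣ ∣ a - b ∣ → CongMod m a b
∣∣-∣⇒CongMod {m} {a} {b} = subst (m ∣_) (sym (∣+m-+n∣≡∣m-n∣ a b))

CongMod⇒∣∸ : ∀ {m a b} → CongMod m a b → b ≤ a → m ∣ a ∸ b
CongMod⇒∣∸ {m} {a} {b} a≡b b≤a = subst (m ∣_) (ℕP.m≤n⇒∣n-m∣≡n∸m b≤a) (CongMod⇒∣∣-∣ {a = a} {b} a≡b)

CongMod⇒∣ : ∀ {m a} → CongMod m a 0 → m ∣ a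
CongMod⇒∣ {m} {a} a≡0 = subst (m ∣_) (ℕP.∣-∣-identityʳ a) (CongMod⇒∣∣-∣ {a = a} {0} a≡0)

CongMod-intro : ∀ {m a b} s t → b + s * m ≡ a + t * m → CongMod m a b
CongMod-intro {m} {a} {b} s t eq = ∣∣-∣⇒CongMod {a = a} {b} (divides ∣ s - t ∣ (begin
  ∣ a - b ∣                      ≡⟨ ℕP.∣m+n-m+o∣≡∣n-o∣ (t * m) a b ⟨
  ∣ t * m + a - t * m + b ∣      ≡⟨ cong₂ ∣_-_∣ (ℕP.+-comm (t * m) a) (ℕP.+-comm (t * m) b) ⟩
  ∣ a + t * m - b + t * m ∣      ≡⟨ cong (λ x → ∣ x - b + t * m ∣) eq ⟨
  ∣ b + s * m - b + t * m ∣      ≡⟨ ℕP.∣m+n-m+o∣≡∣n-o∣ b (s * m) (t * m) ⟩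
  ∣ s * m - t * m ∣              ≡⟨ ℕP.*-distribʳ-∣-∣ m s t ⟨
  ∣ s - t ∣ * m                  ∎))
  where open ≡-Reasoning

CongMod-cancel : ∀ {m a} b c → CongMod m a (b + c) → m ∣ c → CongMod m a b
CongMod-cancel {m} {a} b c a≡b+c m∣c =
  ℤS.∣⇒∣ᵤ (subst (+ m ℤS.∣_) shift (ℤS.∣m∣n⇒∣m+n (ℤS.∣ᵤ⇒∣ {+ m} {+ a ℤ.- + (b + c)} a≡b+c) (ℤS.∣ᵤ⇒∣ {+ m} {+ c} m∣c)))
  where
  open ≡-Reasoning
  sub-add-cancel : ∀ i j k → i ℤ.- (j ℤ.+ k) ℤ.+ k ≡ i ℤ.- j
  sub-add-cancel = ℤSolver.solve-∀
  shift : + a ℤ.- + (b + c) ℤ.+ + c ≡ + a ℤ.- + b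
  shift = begin
    + a ℤ.- + (b + c) ℤ.+ + c        ≡⟨ cong (λ x → + a ℤ.- x ℤ.+ + c) (ℤP.pos-+ b c) ⟩
    + a ℤ.- (+ b ℤ.+ + c) ℤ.+ + c    ≡⟨ sub-add-cancel (+ a) (+ b) (+ c) ⟩
    + a ℤ.- + b                      ∎

CongMod-<+⇒≤ : ∀ {m a b} → CongMod m a b → b < a + m → b ≤ a
CongMod-<+⇒≤ {m} {a} {b} a≡b b<a+m with b ℕP.≤? a
... | yes b≤a = b≤a
... | no  b≰a = ⊥-elim (ℕP.<⇒≱ b<a+m a+m≤b)
  where
  a<b : a < b
  a<b = ℕP.≰⇒> b≰a
  m∣b∸a : m ∣ b ∸ a
  m∣b∸a = subst (m ∣_) (ℕP.m≤n⇒∣m-n∣≡n∸m (ℕP.<⇒≤ a<b)) (CongMod⇒∣∣-∣ {a = a} {b} a≡b)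
  a+m≤b : a + m ≤ b
  a+m≤b = subst (a + m ≤_) (ℕP.m+[n∸m]≡n (ℕP.<⇒≤ a<b))
            (ℕP.+-monoʳ-≤ a (ℕD.∣⇒≤ {{ℕ.>-nonZero (ℕP.m<n⇒0<n∸m a<b)}} m∣b∸a))

least-witness : ∀ {P : ℕ → Set} → (∀ k → Dec (P k)) → ∀ n → P n → ∃ λ k → P k × (∀ j → j < k → ¬ P j)
least-witness P? zero    p = zero , p , λ _ ()
least-witness P? (suc n) p with P? zero
... | yes p₀ = zero , p₀ , λ _ ()
... | no ¬p₀ with least-witness (P? ∘ suc) n p
...   | k , pk , below = suc k , pk , λ { zero _ → ¬p₀ ; (suc j) (s≤s j<k) → below j j<k }

∃CongMod : ∀ m d {n} → gcd (suc m) d ∣ n → ∃ λ r₀ → CongMod (suc m) n (r₀ * d)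
∃CongMod m d {n} (divides k n≡k*g) with Bézout.identity (gcd-GCD (suc m) d)
... | Bézout.+- x y g+yd≡xM = m * (k * y) , CongMod-intro (k * x) (k * y * d) (begin
  m * (k * y) * d + k * x * suc m        ≡⟨ ℕSolver.solve (m ∷ k ∷ x ∷ y ∷ d ∷ []) ⟩
  m * (k * y) * d + k * (x * suc m)      ≡⟨ cong (λ t → m * (k * y) * d + k * t) g+yd≡xM ⟨
  m * (k * y) * d + k * (g + y * d)      ≡⟨ expand m k y d g ⟩
  k * g + k * y * d * suc m              ≡⟨ cong (_+ k * y * d * suc m) n≡k*g ⟨
  n + k * y * d * suc m                  ∎)
  where
  open ≡-Reasoning
  g = gcd (suc m) d
  expand : ∀ m k y d g → m * (k * y) * d + k * (g + y * d) ≡ k * g + k * y * d * suc m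
  expand = ℕSolver.solve-∀
... | Bézout.-+ x y g+xM≡yd = k * y , CongMod-intro 0 (k * x) (begin
  k * y * d + 0 * suc m                  ≡⟨ ℕSolver.solve (m ∷ k ∷ y ∷ d ∷ []) ⟩
  k * (y * d)                            ≡⟨ cong (k *_) g+xM≡yd ⟨
  k * (g + x * suc m)                    ≡⟨ ℕP.*-distribˡ-+ k g (x * suc m) ⟩
  k * g + k * (x * suc m)                ≡⟨ cong (λ t → k * g + t) (ℕP.*-assoc k x (suc m)) ⟨
  k * g + k * x * suc m                  ≡⟨ cong (_+ k * x * suc m) n≡k*g ⟨
  n + k * x * suc m                      ∎)
  where
  open ≡-Reasoning
  g = gcd (suc m) d

∃IsMinimalR : ∀ {m d n} → gcd (suc m) d ∣ n → ¬ suc m ∣ n → ∃ (IsMinimalR (suc m) n d)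
∃IsMinimalR {m} {d} {n} g∣n m∤n with ∃CongMod m d g∣n
... | r₀ , n≡r₀d with least-witness (λ k → suc m ∣? ℤ.∣ + n ℤ.- + (k * d) ∣) r₀ n≡r₀d
...   | zero  , n≡0  , _       = ⊥-elim (m∤n (CongMod⇒∣ n≡0))
...   | suc k , n≡rd , minimal = suc k , s≤s z≤n , n≡rd , λ r′ _ r′<r → minimal r′ r′<r

IsMinimalR⇒<period : ∀ {m n d r p} → IsMinimalR m n d r → ¬ m ∣ n → 0 < p → m ∣ p * d → r < p
IsMinimalR⇒<period {m} {n} {d} {r} {p} (_ , n≡rd , minimal) m∤n 0<p m∣pd with ℕP.<-cmp r p
... | tri< r<p _ _ = r<p
... | tri≈ _ refl _ = ⊥-elim (m∤n (CongMod⇒∣ (CongMod-cancel 0 (p * d) n≡rd m∣pd)))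
... | tri> _ _ p<r = ⊥-elim (minimal (r ∸ p) (ℕP.m<n⇒0<n∸m p<r) (ℕP.∸-monoʳ-< 0<p (ℕP.<⇒≤ p<r))
                                     (CongMod-cancel ((r ∸ p) * d) (p * d) (subst (CongMod m n) split n≡rd) m∣pd))
  where
  split : r * d ≡ (r ∸ p) * d + p * d
  split = trans (cong (_* d) (sym (ℕP.m∸n+n≡m (ℕP.<⇒≤ p<r)))) (ℕP.*-distribʳ-+ d (r ∸ p) p)

IsMinimalR⇒r*d≤n : ∀ {m d n r} → lcm (suc m) (suc d) + 1 ≤ n + suc m + suc d → ¬ suc m ∣ n →
                   IsMinimalR (suc m) n (suc d) r → r * suc d ≤ n
IsMinimalR⇒r*d≤n {m} {d} {n} {r} bound m∤n minR@(_ , n≡rd , _) = CongMod-<+⇒≤ n≡rd rD<n+M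
  where
  open ℕP.≤-Reasoning
  M = suc m
  D = suc d
  L = lcm M D
  p = ℕD.quotient (n∣lcm[m,n] M D)
  L≡pD : L ≡ p * D
  L≡pD = ℕD._∣_.equality (n∣lcm[m,n] M D)
  0<p : 0 < p
  0<p = ℕP.n≢0⇒n>0 λ p≡0 → ℕP.0≢1+n (sym (begin-equality
    M * D              ≡⟨ gcd*lcm M D ⟨
    gcd M D * L        ≡⟨ cong (λ t → gcd M D * t) (trans L≡pD (cong (_* D) p≡0)) ⟩
    gcd M D * 0        ≡⟨ ℕP.*-zeroʳ (gcd M D) ⟩
    0                  ∎))
  r<p : r < p
  r<p = IsMinimalR⇒<period minR m∤n 0<p (subst (M ∣_) L≡pD (m∣lcm[m,n] M D))
  rD<n+M : r * D < n + M
  rD<n+M = ℕP.+-cancelʳ-< D (r * D) (n + M) (begin-strict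
    r * D + D          ≡⟨ ℕP.+-comm (r * D) D ⟩
    suc r * D          ≤⟨ ℕP.*-monoˡ-≤ D r<p ⟩
    p * D              ≡⟨ L≡pD ⟨
    L                  <⟨ ℕP.m<m+n L ℕP.0<1+n ⟩
    L + 1              ≤⟨ bound ⟩
    n + M + D          ∎)

m<[m/n+1]*n : ∀ m n .{{_ : ℕ.NonZero n}} → m < (m / n + 1) * n
m<[m/n+1]*n m n = begin-strict
  m                    ≡⟨ m≡m%n+[m/n]*n m n ⟩
  m % n + m / n * n    <⟨ ℕP.+-monoˡ-< (m / n * n) (m%n<n m n) ⟩
  n + m / n * n        ≡⟨ ℕP.+-comm n (m / n * n) ⟩
  m / n * n + n        ≡⟨ cong (λ t → m / n * n + t) (ℕP.*-identityˡ n) ⟨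
  m / n * n + 1 * n    ≡⟨ ℕP.*-distribʳ-+ n (m / n) 1 ⟨
  (m / n + 1) * n      ∎
  where open ℕP.≤-Reasoning

∃-^≢ : ∀ c m → ∃ λ a → a ≢ + 0 × a ℤ.^ suc m ≢ c
∃-^≢ c m with c ℤP.≟ + 1
... | no  c≢1 = + 1 , (λ ()) , λ 1^m≡c → c≢1 (trans (sym 1^m≡c) (ℤP.^-zeroˡ (suc m)))
... | yes refl = + 2 , (λ ()) , λ 2^M≡1 →
  2≢1 (ℕP.m*n≡1⇒m≡1 2 ℤ.∣ (+ 2) ℤ.^ m ∣ (trans (sym (ℤP.abs-* (+ 2) ((+ 2) ℤ.^ m))) (cong ℤ.∣_∣ 2^M≡1)))
  where
  2≢1 : 2 ≢ 1
  2≢1 ()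

HasDegree--ₚ-≤ : ∀ {p q a n c e} → TopCoeff p a c → TopCoeff q n e → a ≤ n → e ≢ + 0 → e ≢ c → HasDegree (p -ₚ q) n
HasDegree--ₚ-≤ p-top q-top a≤n e≢0 e≢c with ℕP.m≤n⇒m<n∨m≡n a≤n
... | inj₁ a<n  = HasDegree--ₚ (TopCoeff-raise (degree≤ p-top) a<n) q-top (e≢0 ∘ sym)
... | inj₂ refl = HasDegree--ₚ p-top q-top (e≢c ∘ sym)

HasDegree--ₚ-< : ∀ {p q n b c} → TopCoeff p n c → DegreeAtMost q b → b < n → c ≢ + 0 → HasDegree (p -ₚ q) n
HasDegree--ₚ-< p-top q-deg b<n c≢0 = HasDegree--ₚ p-top (TopCoeff-raise q-deg b<n) c≢0

TopCoeff-h^m*homSum : ∀ {h γ a r} m d f → TopCoeff h a (+ 1) → TopCoeff γ r (+ 1) → 0 < r →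
                      TopCoeff ((h ^ₚ m) *ₚ homSum f d γ oneP) (m * a + d * r) (coeff f d)
TopCoeff-h^m*homSum m d f h-top γ-top 0<r =
  subst (TopCoeff _ _) unit-coeffs (TopCoeff-*ₚ (TopCoeff-^ₚ h-top m) (TopCoeff-homSum d γ-top 0<r))
  where
  unit-coeffs : (+ 1) ℤ.^ m ℤ.* (coeff f d ℤ.* (+ 1) ℤ.^ d) ≡ coeff f d
  unit-coeffs = trans (cong₂ (λ x y → x ℤ.* (coeff f d ℤ.* y)) (ℤP.^-zeroˡ m) (ℤP.^-zeroˡ d))
                      (trans (ℤP.*-identityˡ _) (ℤP.*-identityʳ _))

construction-m∣n : ∀ {m d n} f → coeff f (suc d) ≢ + 0 → suc d ≤ n → suc m ∣ n →
  Σ Poly λ g → Σ Poly λ h → Σ Poly λ γ → Σ ℕ λ dg → Σ ℕ λ dh →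
    (dg * suc m ≡ n) × (dh * suc m ≤ n ∸ suc d) × (n ∸ suc d < (dh + 1) * suc m)
    × HasDegree g dg × HasDegree h dh × HasDegree γ 1
    × HasDegree (Fpoly (suc m) (suc d) f g h γ oneP) n
construction-m∣n {m} {d} {n} f c≢0 D≤n (divides q n≡qM) =
  g , h , γ , q , dh ,
  sym n≡qM , m/n*n≤m (n ∸ D) M , m<[m/n+1]*n (n ∸ D) M ,
  TopCoeff⇒HasDegree g-top a≢0 , TopCoeff⇒HasDegree h-top (λ ()) , TopCoeff⇒HasDegree γ-top (λ ()) ,
  HasDegree--ₚ-≤ (TopCoeff-h^m*homSum M D f h-top γ-top (s≤s z≤n)) g^M-top Mdh+D≤n (a≢0 ∘ ℤP.i^n≡0⇒i≡0 a M) a^M≢c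
  where
  M = suc m
  D = suc d
  dh = (n ∸ D) / M
  a : ℤ
  a = proj₁ (∃-^≢ (coeff f D) m)
  a≢0 : a ≢ + 0
  a≢0 = proj₁ (proj₂ (∃-^≢ (coeff f D) m))
  a^M≢c : a ℤ.^ M ≢ coeff f D
  a^M≢c = proj₂ (proj₂ (∃-^≢ (coeff f D) m))
  g = monomial q a
  h = monomial dh (+ 1)
  γ = monomial 1 (+ 1)
  g-top : TopCoeff g q a
  g-top = TopCoeff-monomial q a
  h-top : TopCoeff h dh (+ 1)
  h-top = TopCoeff-monomial dh (+ 1)
  γ-top : TopCoeff γ 1 (+ 1)
  γ-top = TopCoeff-monomial 1 (+ 1)
  g^M-top : TopCoeff ((g ^ₚ M) *ₚ (oneP ^ₚ D)) n (a ℤ.^ M)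
  g^M-top = subst (λ k → TopCoeff ((g ^ₚ M) *ₚ (oneP ^ₚ D)) k (a ℤ.^ M)) (trans (ℕP.*-comm M q) (sym n≡qM))
                  (TopCoeff-*ₚ-oneP^ₚ D (TopCoeff-^ₚ g-top M))
  Mdh+D≤n : M * dh + D * 1 ≤ n
  Mdh+D≤n = begin
    M * dh + D * 1     ≡⟨ cong₂ _+_ (ℕP.*-comm M dh) (ℕP.*-identityʳ D) ⟩
    dh * M + D         ≤⟨ ℕP.+-monoˡ-≤ D (m/n*n≤m (n ∸ D) M) ⟩
    n ∸ D + D          ≡⟨ ℕP.m∸n+n≡m D≤n ⟩
    n                  ∎
    where open ℕP.≤-Reasoning

construction-m∤n : ∀ {m d n} f → coeff f (suc d) ≢ + 0 → lcm (suc m) (suc d) + 1 ≤ n + suc m + suc d →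
  ¬ (suc m ∣ n) → (r : ℕ) → IsMinimalR (suc m) n (suc d) r →
  Σ Poly λ g → Σ Poly λ h → Σ Poly λ γ → Σ ℕ λ dg → Σ ℕ λ dh →
    (dg * suc m ≤ n) × (n < (dg + 1) * suc m) × (dh * suc m + r * suc d ≡ n)
    × HasDegree g dg × HasDegree h dh × HasDegree γ r
    × HasDegree (Fpoly (suc m) (suc d) f g h γ oneP) n
construction-m∤n {m} {d} {n} f c≢0 bound m∤n r minR@(0<r , n≡rd , _) =
  g , h , γ , dg , dh ,
  m/n*n≤m n M , m<[m/n+1]*n n M , dh*M+r*D≡n ,
  TopCoeff⇒HasDegree g-top (λ ()) , TopCoeff⇒HasDegree h-top (λ ()) , TopCoeff⇒HasDegree γ-top (λ ()) ,
  HasDegree--ₚ-< h^M*homSum-top (degree≤ (TopCoeff-*ₚ-oneP^ₚ D (TopCoeff-^ₚ g-top M))) M*dg<n c≢0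
  where
  M = suc m
  D = suc d
  dg = n / M
  rD≤n : r * D ≤ n
  rD≤n = IsMinimalR⇒r*d≤n bound m∤n minR
  M∣n∸rD : M ∣ n ∸ r * D
  M∣n∸rD = CongMod⇒∣∸ n≡rd rD≤n
  dh = ℕD.quotient M∣n∸rD
  g = monomial dg (+ 1)
  h = monomial dh (+ 1)
  γ = monomial r (+ 1)
  g-top : TopCoeff g dg (+ 1)
  g-top = TopCoeff-monomial dg (+ 1)
  h-top : TopCoeff h dh (+ 1)
  h-top = TopCoeff-monomial dh (+ 1)
  γ-top : TopCoeff γ r (+ 1)
  γ-top = TopCoeff-monomial r (+ 1)
  dh*M+r*D≡n : dh * M + r * D ≡ n
  dh*M+r*D≡n = trans (cong (_+ r * D) (sym (ℕD._∣_.equality M∣n∸rD))) (ℕP.m∸n+n≡m rD≤n)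
  h^M*homSum-top : TopCoeff ((h ^ₚ M) *ₚ homSum f D γ oneP) n (coeff f D)
  h^M*homSum-top = subst (λ k → TopCoeff ((h ^ₚ M) *ₚ homSum f D γ oneP) k (coeff f D))
                         (trans (cong₂ _+_ (ℕP.*-comm M dh) (ℕP.*-comm D r)) dh*M+r*D≡n)
                         (TopCoeff-h^m*homSum M D f h-top γ-top 0<r)
  M*dg<n : M * dg < n
  M*dg<n = subst (_< n) (ℕP.*-comm dg M) (ℕP.≤∧≢⇒< (m/n*n≤m n M) λ dg*M≡n → m∤n (divides dg (sym dg*M≡n)))

proposition2p2 : (m d n : ℕ) (f : Poly) → 2 ≤ m → m ≤ d → HasDegree f d → SquareFree f
    → d ≤ n → lcm m d + 1 ≤ n + m + d → gcd m d ∣ n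
    → (Σ Poly λ g → Σ Poly λ h → Σ Poly λ γ → Σ Poly λ η → HasDegree (Fpoly m d f g h γ η) n)
      × (m ∣ n → Σ Poly λ g → Σ Poly λ h → Σ Poly λ γ → Σ ℕ λ dg → Σ ℕ λ dh →
           (dg * m ≡ n) × (dh * m ≤ n ∸ d) × (n ∸ d < (dh + 1) * m)
           × HasDegree g dg × HasDegree h dh × HasDegree γ 1
           × HasDegree (Fpoly m d f g h γ oneP) n)
      × (¬ (m ∣ n) → (r : ℕ) → IsMinimalR m n d r →
           Σ Poly λ g → Σ Poly λ h → Σ Poly λ γ → Σ ℕ λ dg → Σ ℕ λ dh →
           (dg * m ≤ n) × (n < (dg + 1) * m) × (dh * m + r * d ≡ n)
           × HasDegree g dg × HasDegree h dh × HasDegree γ r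
           × HasDegree (Fpoly m d f g h γ oneP) n)
proposition2p2 _ _ n f (s≤s {n = m} _) (s≤s {n = d} _) (c≢0 , _) _ d≤n bound g∣n =
  witness , construction-m∣n f c≢0 d≤n , construction-m∤n f c≢0 bound
  where
  witness : Σ Poly λ g → Σ Poly λ h → Σ Poly λ γ → Σ Poly λ η → HasDegree (Fpoly (suc m) (suc d) f g h γ η) n
  witness with suc m ∣? n
  ... | yes m∣n = let g , h , γ , _ , _ , _ , _ , _ , _ , _ , _ , F = construction-m∣n f c≢0 d≤n m∣n
                  in g , h , γ , oneP , F
  ... | no  m∤n = let r , minR = ∃IsMinimalR g∣n m∤n
                      g , h , γ , _ , _ , _ , _ , _ , _ , _ , _ , F = construction-m∤n f c≢0 bound m∤n r minR
                  in g , h , γ , oneP , F
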